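{- Let $\mathcal{G}$ be a family of graphs each of the form $X_{f,q}$ (with $q$ an odd prime power and $f\in\mathbb{F}_q[x,y]$), and let $d\ge1$. Let $\mathcal{F}_d$ be the family of all graphs $X_{h,q}$ where $X_{f,q}\in\mathcal{G}$, $g\in\mathbb{F}_q[x]$ is a polynomial of degree $d$, and $h(x,y)=f(g(x),g(y))$. If $\mathcal{G}$ is a family of quasi-random graphs with property $QR(1/2)$, then so is $\mathcal{F}_d$.
   Context: An element of $\mathbb{F}_q$ is a square if it equals $z^2$ for some $z\in\mathbb{F}_q$ (so $0$ is a square). For $f\in\mathbb{F}_q[x,y]$, $X_{f,q}$ is the simple graph on $\mathbb{F}_q$ in which distinct $a,b$ are adjacent iff $f(a,b)$ is a square. $e(S,T)$ is the number of pairs $(s,t)\in S\times T$ with $s,t$ adjacent. A family of graphs with unbounded numbers of vertices has property $QR(\theta)$ if there is $c>0$ such that for all $G$ in it with $n$ vertices and all $S,T\subset V(G)$, $|e(S,T)-|S||T|/2|\le cn^\theta\sqrt{|S||T|}$. -}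

module Defs where

open import Level using (0ℓ)
open import Data.Nat using (ℕ; zero; suc; _∸_; _≤_; _<_; _%_; ∣_-_∣) renaming (_+_ to _+ℕ_; _*_ to _*ℕ_)
open import Data.Bool using (Bool; true; false; not; _∧_; _∨_; if_then_else_)
open import Data.Fin using (Fin)
import Data.Fin as Fin
open import Data.Fin.Subset using (Subset; ∣_∣)
open import Data.Fin.Subset.Properties using (_∈?_)
open import Data.List using (List; []; _∷_)
open import Data.Product using (Σ; _×_; ∃)
open import Data.Empty using (⊥)
open import Function.Bundles using (_↔_; Inverse)
open import Relation.Binary.PropositionalEquality using (_≡_; _≢_)
open import Relation.Binary.Definitions using (DecidableEquality)
open import Relation.Nullary.Decidable using (⌊_⌋)
open import Algebra.Core using (Op₁; Op₂)
open import Algebra.Structures using (IsCommutativeRing)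

record FiniteField : Set₁ where
  field
    Carrier : Set
    _+_ _*_ : Op₂ Carrier
    -_ : Op₁ Carrier
    0# 1# : Carrier
    isCommutativeRing : IsCommutativeRing _≡_ _+_ _*_ -_ 0# 1#
    _⁻¹ : Op₁ Carrier
    *-inverse : ∀ x → x ≢ 0# → (x * (x ⁻¹)) ≡ 1#
    0≢1 : 0# ≢ 1#
    _≟_ : DecidableEquality Carrier
    size : ℕ
    enum : Fin size ↔ Carrier

-- q is odd (every finite field has prime-power order, so q is an odd prime power)
OddOrder : FiniteField → Set
OddOrder F = FiniteField.size F % 2 ≡ 1

-- Univariate polynomials: coefficient lists, constant term first.
Poly1 : FiniteField → Set
Poly1 F = List (FiniteField.Carrier F)

-- Bivariate polynomials: f = Σ_i x^i p_i(y), list of the p_i (i = 0,1,...).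
Poly2 : FiniteField → Set
Poly2 F = List (Poly1 F)

module _ (F : FiniteField) where
  open FiniteField F

  eval1 : Poly1 F → Carrier → Carrier
  eval1 [] a = 0#
  eval1 (c ∷ cs) a = c + (a * eval1 cs a)

  eval2 : Poly2 F → Carrier → Carrier → Carrier
  eval2 [] a b = 0#
  eval2 (p ∷ ps) a b = eval1 p b + (a * eval2 ps a b)

  HasDegree : Poly1 F → ℕ → Set
  HasDegree [] d = ⊥
  HasDegree (c ∷ []) zero = c ≢ 0#
  HasDegree (c ∷ []) (suc d) = ⊥
  HasDegree (c ∷ c' ∷ cs) zero = ⊥
  HasDegree (c ∷ c' ∷ cs) (suc d) = HasDegree (c' ∷ cs) d

  elt : Fin size → Carrier
  elt = Inverse.to enum

anyFin : ∀ {n} → (Fin n → Bool) → Bool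
anyFin {zero} p = false
anyFin {suc n} p = p Fin.zero ∨ anyFin (λ i → p (Fin.suc i))

sumFin : ∀ {n} → (Fin n → ℕ) → ℕ
sumFin {zero} f = 0
sumFin {suc n} f = f Fin.zero +ℕ sumFin (λ i → f (Fin.suc i))

module _ (F : FiniteField) where
  open FiniteField F

  -- x is a square: x = z^2 for some z ∈ F_q (so 0 is a square)
  isSquare : Carrier → Bool
  isSquare x = anyFin (λ i → ⌊ (elt F i * elt F i) ≟ x ⌋)

record Graph : Set where
  field
    n : ℕ
    adj : Fin n → Fin n → Bool

X : (F : FiniteField) → (FiniteField.Carrier F → FiniteField.Carrier F → FiniteField.Carrier F) → Graph
X F φ = record
  { n = FiniteField.size F
  ; adj = λ i j → not ⌊ i Fin.≟ j ⌋ ∧ isSquare F (φ (elt F i) (elt F j)) }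

edges : (G : Graph) → Subset (Graph.n G) → Subset (Graph.n G) → ℕ
edges G S T = sumFin (λ i → sumFin (λ j →
  if ⌊ i ∈? S ⌋ ∧ ⌊ j ∈? T ⌋ ∧ Graph.adj G i j then 1 else 0))

-- Property QR(1/2) of a family {G i | P i}: unbounded numbers of vertices, and
-- ∃ c > 0 such that |e(S,T) - |S||T|/2| ≤ c n^{1/2} √(|S||T|) for all members and S,T.
-- Equivalently (squaring and doubling, c taken natural WLOG):
-- |2e(S,T) - |S||T||² ≤ 4c² n |S||T|.
QRhalf : {I : Set₁} → (P : I → Set) → (G : I → Graph) → Set₁
QRhalf {I} P G =
  (∀ m → Σ I (λ i → P i × m < Graph.n (G i))) ×
  Σ ℕ (λ c → 0 < c × (∀ i → P i → (S T : Subset (Graph.n (G i))) →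
     let s = ∣ S ∣ ; t = ∣ T ∣ ; dev = ∣ 2 *ℕ edges (G i) S T - s *ℕ t ∣ in
     dev *ℕ dev ≤ 4 *ℕ (c *ℕ c) *ℕ (Graph.n (G i) *ℕ (s *ℕ t))))

GIndex : Set₁
GIndex = Σ FiniteField Poly2

GGraph : GIndex → Graph
GGraph (F Data.Product., f) = X F (eval2 F f)

FIndex : Set₁
FIndex = Σ FiniteField (λ F → Poly2 F × Poly1 F)

FGraph : FIndex → Graph
FGraph (F Data.Product., (f Data.Product., g)) =
  X F (λ a b → eval2 F f (eval1 F g a) (eval1 F g b))

FMember : (𝒢 : GIndex → Set) → ℕ → FIndex → Set
FMember 𝒢 d (F Data.Product., (f Data.Product., g)) = 𝒢 (F Data.Product., f) × HasDegree F g d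

-- Let γ be the map a ↦ g(a) of F_q. Off the pairs with γ(a) = γ(b), the graph X_{h,q} is
-- the pullback of X_{f,q} along γ, and every fibre of γ has at most d points, since g - v
-- has at most d roots. So e_h(S,T) differs by at most d·min(|S|,|T|) from the weighted
-- edge count Σ σ(u) τ(v) [u ~ v] of X_{f,q}, where σ(u) (resp. τ(u)) is the number of
-- points of S (resp. T) over u, a weight bounded by d. Writing σ = Σ_{k<d} 1_{σ > k} and
-- τ likewise turns the weighted count into Σ_{k,l} e_f(A_k, B_l) with Σ|A_k| = |S| and
-- Σ|B_l| = |T|; the QR(1/2) bounds for these d² pairs, added up by Cauchy–Schwarz, give
-- 𝓕_d the property QR(1/2) with constant 2dc.

module Submission where

open import Defs
open import Data.Nat using (ℕ; _≥_)
open import Data.Product using (_×_; _,_; proj₁)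

open import Level using (0ℓ)
open import Data.Bool using (Bool; true; false; not; _∧_; if_then_else_)
open import Data.Fin using (Fin; zero; suc; toℕ; punchIn)
open import Data.Fin.Properties using (punchInᵢ≢i; any?)
open import Data.Fin.Subset using (Subset; ∣_∣)
open import Data.Fin.Subset.Properties using (_∈?_; ∣p∣≤n)
open import Data.List using ([]; _∷_)
open import Data.Vec using (lookup; tabulate; []; _∷_)
open import Data.Vec.Properties using (lookup∘tabulate)
open import Data.Product using (Σ)
open import Data.Sum using (_⊎_; inj₁; inj₂)
open import Function using (_∘_)
open import Function.Bundles using (Inverse)
open import Relation.Binary.PropositionalEquality
open import Relation.Nullary using (Dec; yes; no; ¬_; contradiction)
open import Relation.Nullary.Decidable using (⌊_⌋; ⌊⌋-map′)
open import Algebra.Bundles using (CommutativeRing)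
open import Algebra.Core using (Op₂)
open import Data.Nat.Properties using (+-*-semiring)
open import Algebra.Properties.Semiring.Sum +-*-semiring
  using (sum; sum-cong-≗; ∑-distrib-+; ∑-comm; *-distribˡ-sum; *-distribʳ-sum; sum-replicate-zero; sum-remove)
open import Data.Nat.Tactic.RingSolver using (solve-∀)

module FiniteSums where

  open import Data.Nat using (zero; suc; _+_; _*_; _∸_; _≤_; z≤n; s≤s; ∣_-_∣)
  open import Data.Nat.Properties hiding (_≟_)
  open import Data.Fin using (_≟_)

  private
    variable
      m n : ℕ
      A B C : Set

  𝟙 : Bool → ℕ
  𝟙 b = if b then 1 else 0

  𝟙≤1 : ∀ b → 𝟙 b ≤ 1
  𝟙≤1 true  = ≤-refl
  𝟙≤1 false = z≤n

  𝟙-∧ : ∀ a b → 𝟙 (a ∧ b) ≡ 𝟙 a * 𝟙 b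
  𝟙-∧ true  b = sym (+-identityʳ (𝟙 b))
  𝟙-∧ false b = refl

  𝟙-yes : (a? : Dec A) → A → 𝟙 ⌊ a? ⌋ ≡ 1
  𝟙-yes (yes _) _ = refl
  𝟙-yes (no ¬a) a = contradiction a ¬a

  𝟙-no : (a? : Dec A) → ¬ A → 𝟙 ⌊ a? ⌋ ≡ 0
  𝟙-no (no _)  _  = refl
  𝟙-no (yes a) ¬a = contradiction a ¬a

  𝟙-mono : (p : Dec A) (q : Dec B) → (A → B) → 𝟙 ⌊ p ⌋ ≤ 𝟙 ⌊ q ⌋
  𝟙-mono (no _)  _       _   = z≤n
  𝟙-mono (yes a) (yes _) _   = ≤-refl
  𝟙-mono (yes a) (no ¬b) a→b = contradiction (a→b a) ¬b

  𝟙-≤-⊎ : (p : Dec A) (q : Dec B) (r : Dec C) → (A → B ⊎ C) →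
          𝟙 ⌊ p ⌋ ≤ 𝟙 ⌊ q ⌋ + 𝟙 ⌊ r ⌋
  𝟙-≤-⊎ (no _)  _ _ _ = z≤n
  𝟙-≤-⊎ (yes a) q r split with split a
  ... | inj₁ b = ≤-trans (𝟙-mono (yes a) q (λ _ → b)) (m≤m+n _ _)
  ... | inj₂ c = ≤-trans (𝟙-mono (yes a) r (λ _ → c)) (m≤n+m _ _)

  sumFin≡sum : (f : Fin n → ℕ) → sumFin f ≡ sum f
  sumFin≡sum {zero}  f = refl
  sumFin≡sum {suc n} f = cong (f zero +_) (sumFin≡sum (λ i → f (suc i)))

  sumFin²≡sum² : (f : Fin m → Fin n → ℕ) → sumFin (λ i → sumFin (f i)) ≡ sum (λ i → sum (f i))
  sumFin²≡sum² f = trans (sumFin≡sum (λ i → sumFin (f i))) (sum-cong-≗ (λ i → sumFin≡sum (f i)))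

  sum-mono-≤ : {f g : Fin n → ℕ} → (∀ i → f i ≤ g i) → sum f ≤ sum g
  sum-mono-≤ {zero}  _   = z≤n
  sum-mono-≤ {suc n} f≤g = +-mono-≤ (f≤g zero) (sum-mono-≤ (λ i → f≤g (suc i)))

  sum-const : ∀ n k → sum {n} (λ _ → k) ≡ n * k
  sum-const zero    k = refl
  sum-const (suc n) k = cong (k +_) (sum-const n k)

  sum-𝟙-≟ : (k : Fin n) (φ : Fin n → ℕ) → sum (λ u → 𝟙 ⌊ k ≟ u ⌋ * φ u) ≡ φ k
  sum-𝟙-≟ {suc n} k φ = begin
    sum (λ u → 𝟙 ⌊ k ≟ u ⌋ * φ u)
      ≡⟨ sum-remove {i = k} (λ u → 𝟙 ⌊ k ≟ u ⌋ * φ u) ⟩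
    𝟙 ⌊ k ≟ k ⌋ * φ k + sum (λ j → 𝟙 ⌊ k ≟ punchIn k j ⌋ * φ (punchIn k j))
      ≡⟨ cong₂ (λ b c → b * φ k + c) (𝟙-yes (k ≟ k) refl)
           (sum-cong-≗ (λ j → cong (_* φ (punchIn k j)) (𝟙-no (k ≟ _) (punchInᵢ≢i k j ∘ sym)))) ⟩
    φ k + 0 + sum {n} (λ _ → 0)
      ≡⟨ cong₂ _+_ (+-identityʳ (φ k)) (sum-replicate-zero n) ⟩
    φ k + 0
      ≡⟨ +-identityʳ (φ k) ⟩
    φ k ∎
    where open ≡-Reasoning

  sum-*-sum : (f : Fin m → ℕ) (g : Fin n → ℕ) → sum f * sum g ≡ sum (λ i → sum (λ j → f i * g j))
  sum-*-sum f g = trans (*-distribʳ-sum (sum g) f) (sum-cong-≗ (λ i → *-distribˡ-sum (f i) g))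

  ∣m+n-o+p∣≤∣m-o∣+∣n-p∣ : ∀ m n o p → ∣ m + n - (o + p) ∣ ≤ ∣ m - o ∣ + ∣ n - p ∣
  ∣m+n-o+p∣≤∣m-o∣+∣n-p∣ m n o p = begin
    ∣ m + n - (o + p) ∣         ≤⟨ ∣-∣-triangle (m + n) (o + n) (o + p) ⟩
    ∣ m + n - (o + n) ∣ + ∣ o + n - (o + p) ∣
      ≡⟨ cong₂ _+_ (trans (cong₂ ∣_-_∣ (+-comm m n) (+-comm o n)) (∣m+n-m+o∣≡∣n-o∣ n m o))
                   (∣m+n-m+o∣≡∣n-o∣ o n p) ⟩
    ∣ m - o ∣ + ∣ n - p ∣ ∎
    where open ≤-Reasoning

  ∣sum-sum∣≤sum∣-∣ : (f g : Fin n → ℕ) → ∣ sum f - sum g ∣ ≤ sum (λ i → ∣ f i - g i ∣)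
  ∣sum-sum∣≤sum∣-∣ {zero}  f g = z≤n
  ∣sum-sum∣≤sum∣-∣ {suc n} f g = ≤-trans (∣m+n-o+p∣≤∣m-o∣+∣n-p∣ (f zero) _ (g zero) _)
    (+-monoʳ-≤ ∣ f zero - g zero ∣ (∣sum-sum∣≤sum∣-∣ (λ i → f (suc i)) (λ i → g (suc i))))

  m≤n⇒2*[m*n]≤m*m+n*n : ∀ {m n} → m ≤ n → 2 * (m * n) ≤ m * m + n * n
  m≤n⇒2*[m*n]≤m*m+n*n {m} {n} m≤n = subst (λ n → 2 * (m * n) ≤ m * m + n * n) (m+[n∸m]≡n m≤n)
    (≤-trans (m≤m+n _ ((n ∸ m) * (n ∸ m))) (≤-reflexive (expand m (n ∸ m))))
    where
    expand : ∀ m k → 2 * (m * (m + k)) + k * k ≡ m * m + (m + k) * (m + k)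
    expand = solve-∀

  2*[m*n]≤m*m+n*n : ∀ m n → 2 * (m * n) ≤ m * m + n * n
  2*[m*n]≤m*m+n*n m n with ≤-total m n
  ... | inj₁ m≤n = m≤n⇒2*[m*n]≤m*m+n*n m≤n
  ... | inj₂ n≤m = subst₂ _≤_ (cong (2 *_) (*-comm n m)) (+-comm (n * n) (m * m))
                            (m≤n⇒2*[m*n]≤m*m+n*n n≤m)

  sum-square-≤ : (x : Fin n → ℕ) → sum x * sum x ≤ n * sum (λ i → x i * x i)
  sum-square-≤ {n} x = *-cancelˡ-≤ 2 (begin
    2 * (sum x * sum x)                             ≡⟨ cong (2 *_) (sum-*-sum x x) ⟩
    2 * sum (λ i → sum (λ j → x i * x j))
      ≡⟨ trans (*-distribˡ-sum 2 (λ i → sum (λ j → x i * x j)))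
               (sum-cong-≗ (λ i → *-distribˡ-sum 2 (λ j → x i * x j))) ⟩
    sum (λ i → sum (λ j → 2 * (x i * x j)))
      ≤⟨ sum-mono-≤ (λ i → sum-mono-≤ (λ j → 2*[m*n]≤m*m+n*n (x i) (x j))) ⟩
    sum (λ i → sum (λ j → x i * x i + x j * x j))
      ≡⟨ sum-cong-≗ (λ i → trans (∑-distrib-+ {n} (λ _ → x i * x i) (λ j → x j * x j))
                                 (cong (_+ Q) (sum-const n (x i * x i)))) ⟩
    sum (λ i → n * (x i * x i) + Q)                 ≡⟨ ∑-distrib-+ (λ i → n * (x i * x i)) (λ _ → Q) ⟩
    sum (λ i → n * (x i * x i)) + sum {n} (λ _ → Q)
      ≡⟨ cong₂ _+_ (sym (*-distribˡ-sum n (λ i → x i * x i))) (sum-const n Q) ⟩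
    n * Q + n * Q                                   ≡⟨ cong (n * Q +_) (sym (+-identityʳ (n * Q))) ⟩
    2 * (n * Q)                                     ∎)
    where
    open ≤-Reasoning
    Q = sum (λ j → x j * x j)

  sum²-square-≤ : (x : Fin m → Fin n → ℕ) (a : Fin m → ℕ) (b : Fin n → ℕ) →
    (∀ k l → x k l * x k l ≤ a k * b l) →
    sum (λ k → sum (x k)) * sum (λ k → sum (x k)) ≤ m * n * (sum a * sum b)
  sum²-square-≤ {m} {n} x a b x²≤ab = begin
    sum (λ k → sum (x k)) * sum (λ k → sum (x k))      ≤⟨ sum-square-≤ (λ k → sum (x k)) ⟩
    m * sum (λ k → sum (x k) * sum (x k))              ≤⟨ *-monoʳ-≤ m (sum-mono-≤ row) ⟩
    m * sum (λ k → n * sum (λ l → a k * b l))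
      ≡⟨ cong (m *_) (trans (sym (*-distribˡ-sum n (λ k → sum (λ l → a k * b l))))
                            (cong (n *_) (sym (sum-*-sum a b)))) ⟩
    m * (n * (sum a * sum b))                          ≡⟨ sym (*-assoc m n _) ⟩
    m * n * (sum a * sum b)                            ∎
    where
    open ≤-Reasoning
    row : ∀ k → sum (x k) * sum (x k) ≤ n * sum (λ l → a k * b l)
    row k = ≤-trans (sum-square-≤ (x k)) (*-monoʳ-≤ n (sum-mono-≤ (x²≤ab k)))

  m≤n+o⇒m*m≤4*k : ∀ {m n o k} → m ≤ n + o → n * n ≤ k → o * o ≤ k → m * m ≤ 4 * k
  m≤n+o⇒m*m≤4*k {m} {n} {o} {k} m≤n+o n²≤k o²≤k = begin
    m * m                                 ≤⟨ *-mono-≤ m≤n+o m≤n+o ⟩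
    (n + o) * (n + o)                     ≡⟨ expand n o ⟩
    n * n + o * o + 2 * (n * o)           ≤⟨ +-monoʳ-≤ (n * n + o * o) (2*[m*n]≤m*m+n*n n o) ⟩
    n * n + o * o + (n * n + o * o)       ≤⟨ +-mono-≤ n²+o²≤2k n²+o²≤2k ⟩
    (k + k) + (k + k)                     ≡⟨ collect k ⟩
    4 * k                                 ∎
    where
    open ≤-Reasoning
    n²+o²≤2k = +-mono-≤ n²≤k o²≤k
    expand : ∀ n o → (n + o) * (n + o) ≡ n * n + o * o + 2 * (n * o)
    expand = solve-∀
    collect : ∀ k → (k + k) + (k + k) ≡ 4 * k
    collect = solve-∀

  ∣sum²-sum²∣≤sum²∣-∣ : (f g : Fin m → Fin n → ℕ) →
    ∣ sum (λ k → sum (f k)) - sum (λ k → sum (g k)) ∣ ≤ sum (λ k → sum (λ l → ∣ f k l - g k l ∣))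
  ∣sum²-sum²∣≤sum²∣-∣ f g = ≤-trans (∣sum-sum∣≤sum∣-∣ (λ k → sum (f k)) (λ k → sum (g k)))
                                    (sum-mono-≤ (λ k → ∣sum-sum∣≤sum∣-∣ (f k) (g k)))

  n≤m≤n+o⇒∣2m-k∣≤∣2n-k∣+2o : ∀ {m n o} k → n ≤ m → m ≤ n + o →
                              ∣ 2 * m - k ∣ ≤ ∣ 2 * n - k ∣ + 2 * o
  n≤m≤n+o⇒∣2m-k∣≤∣2n-k∣+2o {m} {n} {o} k n≤m m≤n+o = begin
    ∣ 2 * m - k ∣                       ≤⟨ ∣-∣-triangle (2 * m) (2 * n) k ⟩
    ∣ 2 * m - 2 * n ∣ + ∣ 2 * n - k ∣   ≡⟨ +-comm _ ∣ 2 * n - k ∣ ⟩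
    ∣ 2 * n - k ∣ + ∣ 2 * m - 2 * n ∣   ≡⟨ cong (∣ 2 * n - k ∣ +_) (sym (*-distribˡ-∣-∣ 2 m n)) ⟩
    ∣ 2 * n - k ∣ + 2 * ∣ m - n ∣
      ≡⟨ cong (λ x → ∣ 2 * n - k ∣ + 2 * x) (m≤n⇒∣n-m∣≡n∸m n≤m) ⟩
    ∣ 2 * n - k ∣ + 2 * (m ∸ n)
      ≤⟨ +-monoʳ-≤ ∣ 2 * n - k ∣ (*-monoʳ-≤ 2 (m≤n+o⇒m∸n≤o m n m≤n+o)) ⟩
    ∣ 2 * n - k ∣ + 2 * o               ∎
    where open ≤-Reasoning

  m≤n⇒m*k≤n*[m*k] : ∀ {m n} k → m ≤ n → m * k ≤ n * (m * k)
  m≤n⇒m*k≤n*[m*k] k z≤n             = z≤n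
  m≤n⇒m*k≤n*[m*k] k (s≤s {n = n} _) = m≤n*m _ (suc n)

  sum-𝟙≤-byWitness : {P : Fin n → Set} (P? : ∀ i → Dec (P i)) →
    (∀ i → P i → sum (λ j → 𝟙 ⌊ P? j ⌋) ≤ m) → sum (λ j → 𝟙 ⌊ P? j ⌋) ≤ m
  sum-𝟙≤-byWitness {n} P? bound with any? P?
  ... | yes (i , Pi) = bound i Pi
  ... | no ∄P = ≤-trans (sum-mono-≤ (λ j → ≤-reflexive (𝟙-no (P? j) (λ Pj → ∄P (j , Pj)))))
                        (≤-trans (≤-reflexive (sum-replicate-zero n)) z≤n)

module Polynomials (F : FiniteField) where

  open import Data.Nat using (zero; suc; _≤_; s≤s) renaming (_+_ to _+ℕ_)
  open import Data.Nat.Properties using (≤-trans; ≤-reflexive; *-identityʳ; +-monoˡ-≤; module ≤-Reasoning)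
  open FiniteSums

  open FiniteField F using (Carrier; _≟_; _⁻¹; *-inverse; enum; isCommutativeRing)

  commutativeRing : CommutativeRing 0ℓ 0ℓ
  commutativeRing = record { isCommutativeRing = isCommutativeRing }

  open CommutativeRing commutativeRing
    using ( _+_; _*_; _-_; 0#; 1#; +-identityˡ; +-identityʳ; *-identityˡ; *-assoc; *-comm; zeroʳ
          ; ring; commutativeSemiring)
  open import Algebra.Properties.Ring ring using (//-rightDividesˡ; x∙y⁻¹≈ε⇒x≈y; +-cancelʳ)
  open import Algebra.Solver.Ring.NaturalCoefficients.Default commutativeSemiring
    using (solve; _:+_; _:*_; _:=_)

  eval : Poly1 F → Carrier → Carrier
  eval = eval1 F

  quotient : Carrier → Poly1 F → Poly1 F
  quotient a []            = []
  quotient a (c ∷ [])      = []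
  quotient a (c ∷ c′ ∷ cs) = eval (c′ ∷ cs) a ∷ quotient a (c′ ∷ cs)

  eval-const : ∀ c x → eval (c ∷ []) x ≡ c
  eval-const c x = trans (cong (c +_) (zeroʳ x)) (+-identityʳ c)

  -- The factor theorem p(x) = (x - a)·q(x) + p(a), written at x = u + a so that it is an
  -- identity of commutative semirings.
  eval-quotient : ∀ p u a → eval p (u + a) ≡ u * eval (quotient a p) (u + a) + eval p a
  eval-quotient []            u a = sym (trans (+-identityʳ (u * 0#)) (zeroʳ u))
  eval-quotient (c ∷ [])      u a =
    trans (eval-const c (u + a)) (sym (trans (cong₂ _+_ (zeroʳ u) (eval-const c a)) (+-identityˡ c)))
  eval-quotient (c ∷ c′ ∷ cs) u a =
    trans (cong (λ y → c + (u + a) * y) (eval-quotient (c′ ∷ cs) u a))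
          (horner u a c (eval (quotient a (c′ ∷ cs)) (u + a)) (eval (c′ ∷ cs) a))
    where
    horner : ∀ u a c Q P → c + (u + a) * (u * Q + P) ≡ u * (P + (u + a) * Q) + (c + a * P)
    horner = solve 5 (λ u a c Q P → c :+ (u :+ a) :* (u :* Q :+ P)
                                   := u :* (P :+ (u :+ a) :* Q) :+ (c :+ a :* P)) refl

  quotient-degree : ∀ {a} p d → HasDegree F p (suc d) → HasDegree F (quotient a p) d
  quotient-degree {a} (c ∷ c′ ∷ [])      zero    c′≢0 c′+a*0≡0 = c′≢0 (trans (sym (eval-const c′ a)) c′+a*0≡0)
  quotient-degree     (c ∷ c′ ∷ c″ ∷ cs) (suc d) deg  = quotient-degree (c′ ∷ c″ ∷ cs) d deg

  x*y≡0⇒x≡0⊎y≡0 : ∀ x y → x * y ≡ 0# → x ≡ 0# ⊎ y ≡ 0#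
  x*y≡0⇒x≡0⊎y≡0 x y xy≡0 with x ≟ 0#
  ... | yes x≡0 = inj₁ x≡0
  ... | no  x≢0 = inj₂ (begin
    y                 ≡⟨ sym (*-identityˡ y) ⟩
    1# * y            ≡⟨ cong (_* y) (trans (sym (*-inverse x x≢0)) (*-comm x (x ⁻¹))) ⟩
    (x ⁻¹ * x) * y    ≡⟨ *-assoc (x ⁻¹) x y ⟩
    x ⁻¹ * (x * y)    ≡⟨ cong (x ⁻¹ *_) xy≡0 ⟩
    x ⁻¹ * 0#         ≡⟨ zeroʳ (x ⁻¹) ⟩
    0#                ∎)
    where open ≡-Reasoning

  factor : ∀ p a x → eval p x ≡ eval p a → x ≡ a ⊎ eval (quotient a p) x ≡ 0#
  factor p a x px≡pa with x*y≡0⇒x≡0⊎y≡0 (x - a) (eval (quotient a p) x) [x-a]*q≡0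
    where
    x-a+a≡x : (x - a) + a ≡ x
    x-a+a≡x = //-rightDividesˡ a x
    [x-a]*q≡0 : (x - a) * eval (quotient a p) x ≡ 0#
    [x-a]*q≡0 = +-cancelʳ (eval p a) _ _ (begin
      (x - a) * eval (quotient a p) x + eval p a
        ≡⟨ cong (λ y → (x - a) * eval (quotient a p) y + eval p a) (sym x-a+a≡x) ⟩
      (x - a) * eval (quotient a p) (x - a + a) + eval p a ≡⟨ sym (eval-quotient p (x - a) a) ⟩
      eval p (x - a + a)                                   ≡⟨ cong (eval p) x-a+a≡x ⟩
      eval p x                                             ≡⟨ px≡pa ⟩
      eval p a                                             ≡⟨ sym (+-identityˡ (eval p a)) ⟩
      0# + eval p a                                        ∎)
      where open ≡-Reasoning
  ... | inj₁ x-a≡0 = inj₁ (x∙y⁻¹≈ε⇒x≈y x a x-a≡0)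
  ... | inj₂ q≡0   = inj₂ q≡0

  preimageSize : Poly1 F → Carrier → ℕ
  preimageSize p v = sum (λ i → 𝟙 ⌊ eval p (elt F i) ≟ v ⌋)

  sum-𝟙[elt≡] : ∀ a → sum (λ i → 𝟙 ⌊ elt F i ≟ a ⌋) ≤ 1
  sum-𝟙[elt≡] a = ≤-trans
    (sum-mono-≤ (λ i → ≤-trans (𝟙-mono (elt F i ≟ a) (from a Data.Fin.≟ i) (index i))
                               (≤-reflexive (sym (*-identityʳ _)))))
    (≤-reflexive (sum-𝟙-≟ (from a) (λ _ → 1)))
    where
    from = Inverse.from enum
    index : ∀ i → elt F i ≡ a → from a ≡ i
    index i refl = Inverse.strictlyInverseʳ enum i

  preimageSize-step : ∀ p a {v} → eval p a ≡ v → preimageSize p v ≤ suc (preimageSize (quotient a p) 0#)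
  preimageSize-step p a {v} pa≡v = begin
    preimageSize p v
      ≤⟨ sum-mono-≤ (λ i → 𝟙-≤-⊎ (eval p (x i) ≟ v) (x i ≟ a) (eval q (x i) ≟ 0#)
                                 (λ px≡v → factor p a (x i) (trans px≡v (sym pa≡v)))) ⟩
    sum (λ i → 𝟙 ⌊ x i ≟ a ⌋ +ℕ 𝟙 ⌊ eval q (x i) ≟ 0# ⌋)
      ≡⟨ ∑-distrib-+ (λ i → 𝟙 ⌊ x i ≟ a ⌋) (λ i → 𝟙 ⌊ eval q (x i) ≟ 0# ⌋) ⟩
    sum (λ i → 𝟙 ⌊ x i ≟ a ⌋) +ℕ preimageSize q 0#
      ≤⟨ +-monoˡ-≤ (preimageSize q 0#) (sum-𝟙[elt≡] a) ⟩
    suc (preimageSize q 0#) ∎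
    where
    open ≤-Reasoning
    x = elt F
    q = quotient a p

  roots≤degree : ∀ p d → HasDegree F p d → preimageSize p 0# ≤ d
  roots≤degree p d deg =
    sum-𝟙≤-byWitness (λ i → eval p (elt F i) ≟ 0#) (λ i → root-bound d p deg (elt F i))
    where
    root-bound : ∀ d p → HasDegree F p d → ∀ a → eval p a ≡ 0# → preimageSize p 0# ≤ d
    root-bound zero    (c ∷ []) c≢0 a c+a*0≡0 = contradiction (trans (sym (eval-const c a)) c+a*0≡0) c≢0
    root-bound (suc d) p        deg a pa≡0    =
      ≤-trans (preimageSize-step p a pa≡0)
              (s≤s (roots≤degree (quotient a p) d (quotient-degree p d deg)))

  preimageSize≤degree : ∀ p d v → HasDegree F p (suc d) → preimageSize p v ≤ suc d
  preimageSize≤degree p d v deg = sum-𝟙≤-byWitness (λ i → eval p (elt F i) ≟ v) (λ i pa≡v →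
    ≤-trans (preimageSize-step p (elt F i) pa≡v)
            (s≤s (roots≤degree (quotient (elt F i) p) d (quotient-degree p d deg))))

  monomial : ℕ → Poly1 F
  monomial zero    = 1# ∷ []
  monomial (suc k) = 0# ∷ monomial k

  monomial-degree : ∀ k → HasDegree F (monomial k) k
  monomial-degree zero          = FiniteField.0≢1 F ∘ sym
  monomial-degree (suc zero)    = FiniteField.0≢1 F ∘ sym
  monomial-degree (suc (suc k)) = monomial-degree (suc k)

open import Data.Nat using (zero; suc; _+_; _*_; _≤_; _<_; _<ᵇ_; z≤n; s≤s; ∣_-_∣)
open import Data.Nat.Properties hiding (_≟_)
open import Data.Fin using (_≟_)
open FiniteSums
open Polynomials using (eval; monomial; monomial-degree; preimageSize≤degree)

private
  variable
    d m n : ℕ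

𝟙[_] : Subset n → Fin n → ℕ
𝟙[ S ] i = 𝟙 (lookup S i)

∣S∣≡sum𝟙[S] : (S : Subset n) → ∣ S ∣ ≡ sum 𝟙[ S ]
∣S∣≡sum𝟙[S] []          = refl
∣S∣≡sum𝟙[S] (true ∷ S)  = cong suc (∣S∣≡sum𝟙[S] S)
∣S∣≡sum𝟙[S] (false ∷ S) = ∣S∣≡sum𝟙[S] S

⌊∈?⌋≡lookup : (i : Fin n) (S : Subset n) → ⌊ i ∈? S ⌋ ≡ lookup S i
⌊∈?⌋≡lookup zero    (true ∷ S)  = refl
⌊∈?⌋≡lookup zero    (false ∷ S) = refl
⌊∈?⌋≡lookup (suc i) (_ ∷ S)     = trans (⌊⌋-map′ _ _ (i ∈? S)) (⌊∈?⌋≡lookup i S)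

bilinear : (Fin m → Fin n → ℕ) → (Fin m → ℕ) → (Fin n → ℕ) → ℕ
bilinear K σ τ = sum (λ u → σ u * sum (λ v → τ v * K u v))

kernel : (G : Graph) → Fin (Graph.n G) → Fin (Graph.n G) → ℕ
kernel G u v = 𝟙 (Graph.adj G u v)

edges≡bilinear : (G : Graph) (S T : Subset (Graph.n G)) → edges G S T ≡ bilinear (kernel G) 𝟙[ S ] 𝟙[ T ]
edges≡bilinear G S T = begin
  edges G S T
    ≡⟨ sumFin²≡sum² (λ i j → 𝟙 (⌊ i ∈? S ⌋ ∧ ⌊ j ∈? T ⌋ ∧ Graph.adj G i j)) ⟩
  sum (λ i → sum (λ j → 𝟙 (⌊ i ∈? S ⌋ ∧ ⌊ j ∈? T ⌋ ∧ Graph.adj G i j)))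
    ≡⟨ sum-cong-≗ (λ i → sum-cong-≗ (λ j → split i j)) ⟩
  sum (λ i → sum (λ j → 𝟙[ S ] i * (𝟙[ T ] j * kernel G i j)))
    ≡⟨ sum-cong-≗ (λ i → sym (*-distribˡ-sum (𝟙[ S ] i) (λ j → 𝟙[ T ] j * kernel G i j))) ⟩
  bilinear (kernel G) 𝟙[ S ] 𝟙[ T ] ∎
  where
  open ≡-Reasoning
  split : ∀ i j → 𝟙 (⌊ i ∈? S ⌋ ∧ ⌊ j ∈? T ⌋ ∧ Graph.adj G i j) ≡ 𝟙[ S ] i * (𝟙[ T ] j * kernel G i j)
  split i j rewrite 𝟙-∧ ⌊ i ∈? S ⌋ (⌊ j ∈? T ⌋ ∧ Graph.adj G i j) | 𝟙-∧ ⌊ j ∈? T ⌋ (Graph.adj G i j)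
                  | ⌊∈?⌋≡lookup i S | ⌊∈?⌋≡lookup j T = refl

bilinear-cong : (K : Fin m → Fin n → ℕ) {σ σ′ : Fin m → ℕ} {τ τ′ : Fin n → ℕ} →
  (∀ u → σ u ≡ σ′ u) → (∀ v → τ v ≡ τ′ v) → bilinear K σ τ ≡ bilinear K σ′ τ′
bilinear-cong K σ≗σ′ τ≗τ′ =
  sum-cong-≗ (λ u → cong₂ _*_ (σ≗σ′ u) (sum-cong-≗ (λ v → cong (_* K u v) (τ≗τ′ v))))

module _ {K K′ : Fin m → Fin n → ℕ} {σ : Fin m → ℕ} {τ : Fin n → ℕ} where

  bilinear-mono-≤ : (∀ u v → K u v ≤ K′ u v) → bilinear K σ τ ≤ bilinear K′ σ τ
  bilinear-mono-≤ K≤K′ =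
    sum-mono-≤ (λ u → *-monoʳ-≤ (σ u) (sum-mono-≤ (λ v → *-monoʳ-≤ (τ v) (K≤K′ u v))))

  bilinear-+ : bilinear (λ u v → K u v + K′ u v) σ τ ≡ bilinear K σ τ + bilinear K′ σ τ
  bilinear-+ = trans (sum-cong-≗ row)
    (∑-distrib-+ (λ u → σ u * sum (λ v → τ v * K u v)) (λ u → σ u * sum (λ v → τ v * K′ u v)))
    where
    row : ∀ u → σ u * sum (λ v → τ v * (K u v + K′ u v))
              ≡ σ u * sum (λ v → τ v * K u v) + σ u * sum (λ v → τ v * K′ u v)
    row u = trans (cong (σ u *_) (trans (sum-cong-≗ (λ v → *-distribˡ-+ (τ v) (K u v) (K′ u v)))
                                        (∑-distrib-+ (λ v → τ v * K u v) (λ v → τ v * K′ u v))))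
                  (*-distribˡ-+ (σ u) _ _)

module _ (K : Fin m → Fin n → ℕ) where

  bilinear-linearˡ : (α : Fin d → Fin m → ℕ) (τ : Fin n → ℕ) →
    bilinear K (λ u → sum (λ k → α k u)) τ ≡ sum (λ k → bilinear K (α k) τ)
  bilinear-linearˡ α τ = trans (sum-cong-≗ (λ u → *-distribʳ-sum (R u) (λ k → α k u)))
                               (∑-comm (λ u k → α k u * R u))
    where
    R : Fin m → ℕ
    R u = sum (λ v → τ v * K u v)

  bilinear-linearʳ : (σ : Fin m → ℕ) (β : Fin d → Fin n → ℕ) →
    bilinear K σ (λ v → sum (λ l → β l v)) ≡ sum (λ l → bilinear K σ (β l))
  bilinear-linearʳ σ β = trans (sum-cong-≗ row) (∑-comm (λ u l → σ u * sum (λ v → β l v * K u v)))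
    where
    row : ∀ u → σ u * sum (λ v → sum (λ l → β l v) * K u v)
              ≡ sum (λ l → σ u * sum (λ v → β l v * K u v))
    row u = trans (cong (σ u *_) (trans (sum-cong-≗ (λ v → *-distribʳ-sum (K u v) (λ l → β l v)))
                                        (∑-comm (λ v l → β l v * K u v))))
                  (*-distribˡ-sum (σ u) (λ l → sum (λ v → β l v * K u v)))

push : (Fin m → Fin n) → (Fin m → ℕ) → Fin n → ℕ
push γ w u = sum (λ i → w i * 𝟙 ⌊ γ i ≟ u ⌋)

fibreSize : (Fin m → Fin n) → Fin n → ℕ
fibreSize γ u = sum (λ i → 𝟙 ⌊ γ i ≟ u ⌋)

module _ (γ : Fin m → Fin n) where

  sum-push : (w : Fin m → ℕ) (φ : Fin n → ℕ) →
             sum (λ i → w i * φ (γ i)) ≡ sum (λ u → push γ w u * φ u)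
  sum-push w φ = begin
    sum (λ i → w i * φ (γ i))
      ≡⟨ sum-cong-≗ (λ i → cong (w i *_) (sym (sum-𝟙-≟ (γ i) φ))) ⟩
    sum (λ i → w i * sum (λ u → 𝟙 ⌊ γ i ≟ u ⌋ * φ u))
      ≡⟨ sum-cong-≗ (λ i → *-distribˡ-sum (w i) (λ u → 𝟙 ⌊ γ i ≟ u ⌋ * φ u)) ⟩
    sum (λ i → sum (λ u → w i * (𝟙 ⌊ γ i ≟ u ⌋ * φ u)))
      ≡⟨ ∑-comm (λ i u → w i * (𝟙 ⌊ γ i ≟ u ⌋ * φ u)) ⟩
    sum (λ u → sum (λ i → w i * (𝟙 ⌊ γ i ≟ u ⌋ * φ u)))
      ≡⟨ sum-cong-≗ (λ u → trans (sum-cong-≗ (λ i → sym (*-assoc (w i) _ (φ u))))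
                                 (sym (*-distribʳ-sum (φ u) (λ i → w i * 𝟙 ⌊ γ i ≟ u ⌋)))) ⟩
    sum (λ u → push γ w u * φ u) ∎
    where open ≡-Reasoning

  sum-push-total : (w : Fin m → ℕ) → sum (push γ w) ≡ sum w
  sum-push-total w = begin
    sum (push γ w)                      ≡⟨ sum-cong-≗ (λ u → sym (*-identityʳ (push γ w u))) ⟩
    sum (λ u → push γ w u * 1)          ≡⟨ sym (sum-push w (λ _ → 1)) ⟩
    sum (λ i → w i * 1)                 ≡⟨ sum-cong-≗ (λ i → *-identityʳ (w i)) ⟩
    sum w                               ∎
    where open ≡-Reasoning

  push-≤-fibreSize : (w : Fin m → ℕ) → (∀ i → w i ≤ 1) → ∀ u → push γ w u ≤ fibreSize γ u
  push-≤-fibreSize w w≤1 u =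
    sum-mono-≤ (λ i → ≤-trans (*-monoˡ-≤ _ (w≤1 i)) (≤-reflexive (*-identityˡ _)))

bilinear-pullback : (K : Fin n → Fin n → ℕ) (γ : Fin m → Fin n) (σ τ : Fin m → ℕ) →
  bilinear (λ i j → K (γ i) (γ j)) σ τ ≡ bilinear K (push γ σ) (push γ τ)
bilinear-pullback K γ σ τ = trans
  (sum-cong-≗ (λ i → cong (σ i *_) (sum-push γ τ (K (γ i)))))
  (sum-push γ σ (λ u → sum (λ v → push γ τ v * K u v)))

diagonal : Fin n → Fin n → ℕ
diagonal u v = 𝟙 ⌊ u ≟ v ⌋

bilinear-diagonal : (σ τ : Fin n → ℕ) → bilinear diagonal σ τ ≡ sum (λ u → σ u * τ u)
bilinear-diagonal σ τ = sum-cong-≗ (λ u → cong (σ u *_)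
  (trans (sum-cong-≗ (λ v → *-comm (τ v) _)) (sum-𝟙-≟ u τ)))

bilinear-diagonal-square : {σ τ : Fin n → ℕ} → (∀ u → σ u ≤ d) → (∀ u → τ u ≤ d) →
  let C = bilinear diagonal σ τ in C * C ≤ d * d * (sum σ * sum τ)
bilinear-diagonal-square {d = d} {σ} {τ} σ≤d τ≤d = begin
  C * C                         ≤⟨ *-mono-≤ C≤∑σ*d C≤d*∑τ ⟩
  (sum σ * d) * (d * sum τ)     ≡⟨ rearrange (sum σ) d (sum τ) ⟩
  d * d * (sum σ * sum τ)       ∎
  where
  open ≤-Reasoning
  C = bilinear diagonal σ τ
  C≤∑σ*d : C ≤ sum σ * d
  C≤∑σ*d = ≤-trans (≤-reflexive (bilinear-diagonal σ τ))
    (≤-trans (sum-mono-≤ (λ u → *-monoʳ-≤ (σ u) (τ≤d u))) (≤-reflexive (sym (*-distribʳ-sum d σ))))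
  C≤d*∑τ : C ≤ d * sum τ
  C≤d*∑τ = ≤-trans (≤-reflexive (bilinear-diagonal σ τ))
    (≤-trans (sum-mono-≤ (λ u → *-monoˡ-≤ (τ u) (σ≤d u))) (≤-reflexive (sym (*-distribˡ-sum d τ))))
  rearrange : ∀ a d b → (a * d) * (d * b) ≡ d * d * (a * b)
  rearrange = solve-∀

level : (Fin n → ℕ) → Fin d → Subset n
level σ k = tabulate (λ u → toℕ k <ᵇ σ u)

sum-𝟙[toℕ<ᵇ] : ∀ {m d} → m ≤ d → sum {d} (λ k → 𝟙 (toℕ k <ᵇ m)) ≡ m
sum-𝟙[toℕ<ᵇ] {d = d} z≤n = sum-replicate-zero d
sum-𝟙[toℕ<ᵇ] (s≤s m≤d)    = cong suc (sum-𝟙[toℕ<ᵇ] m≤d)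

module _ {σ : Fin n → ℕ} (σ≤d : ∀ u → σ u ≤ d) where

  sum-𝟙[level] : ∀ u → sum {d} (λ k → 𝟙[ level σ k ] u) ≡ σ u
  sum-𝟙[level] u = trans (sum-cong-≗ {d} (λ k → cong 𝟙 (lookup∘tabulate (λ v → toℕ k <ᵇ σ v) u)))
                         (sum-𝟙[toℕ<ᵇ] (σ≤d u))

  sum-∣level∣ : sum {d} (λ k → ∣ level σ k ∣) ≡ sum σ
  sum-∣level∣ = begin
    sum {d} (λ k → ∣ level σ k ∣)              ≡⟨ sum-cong-≗ {d} (λ k → ∣S∣≡sum𝟙[S] (level σ k)) ⟩
    sum {d} (λ k → sum (λ u → 𝟙[ level σ k ] u)) ≡⟨ ∑-comm {d} (λ k u → 𝟙[ level σ k ] u) ⟩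
    sum (λ u → sum {d} (λ k → 𝟙[ level σ k ] u)) ≡⟨ sum-cong-≗ sum-𝟙[level] ⟩
    sum σ                                    ∎
    where open ≡-Reasoning

deviation : (G : Graph) → Subset (Graph.n G) → Subset (Graph.n G) → ℕ
deviation G S T = ∣ 2 * edges G S T - ∣ S ∣ * ∣ T ∣ ∣

QRBound : Graph → ℕ → Set
QRBound G c = (S T : Subset (Graph.n G)) →
  deviation G S T * deviation G S T ≤ 4 * (c * c) * (Graph.n G * (∣ S ∣ * ∣ T ∣))

module _ (G : Graph) {c d : ℕ} (qr : QRBound G c) {σ τ : Fin (Graph.n G) → ℕ}
         (σ≤d : ∀ u → σ u ≤ d) (τ≤d : ∀ v → τ v ≤ d) where

  private
    A B : Fin d → Subset (Graph.n G)
    A = level σ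
    B = level τ
    a b : Fin d → ℕ
    a k = ∣ A k ∣
    b l = ∣ B l ∣
    e dev : Fin d → Fin d → ℕ
    e k l = edges G (A k) (B l)
    dev k l = deviation G (A k) (B l)

    bilinear≡sum-edges : bilinear (kernel G) σ τ ≡ sum (λ k → sum (e k))
    bilinear≡sum-edges = begin
      bilinear (kernel G) σ τ
        ≡⟨ bilinear-cong (kernel G) (sym ∘ sum-𝟙[level] σ≤d) (sym ∘ sum-𝟙[level] τ≤d) ⟩
      bilinear (kernel G) (λ u → sum (λ k → 𝟙[ A k ] u)) (λ v → sum (λ l → 𝟙[ B l ] v))
        ≡⟨ bilinear-linearˡ (kernel G) (λ k → 𝟙[ A k ]) (λ v → sum (λ l → 𝟙[ B l ] v)) ⟩
      sum (λ k → bilinear (kernel G) 𝟙[ A k ] (λ v → sum (λ l → 𝟙[ B l ] v)))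
        ≡⟨ sum-cong-≗ (λ k → bilinear-linearʳ (kernel G) 𝟙[ A k ] (λ l → 𝟙[ B l ])) ⟩
      sum (λ k → sum (λ l → bilinear (kernel G) 𝟙[ A k ] 𝟙[ B l ]))
        ≡⟨ sum-cong-≗ (λ k → sum-cong-≗ (λ l → sym (edges≡bilinear G (A k) (B l)))) ⟩
      sum (λ k → sum (e k)) ∎
      where open ≡-Reasoning

    deviation≤sum-dev : ∣ 2 * bilinear (kernel G) σ τ - sum σ * sum τ ∣ ≤ sum (λ k → sum (dev k))
    deviation≤sum-dev = subst (_≤ sum (λ k → sum (dev k))) (sym (cong₂ ∣_-_∣ twice-edges product))
      (∣sum²-sum²∣≤sum²∣-∣ (λ k l → 2 * e k l) (λ k l → a k * b l))
      where
      twice-edges : 2 * bilinear (kernel G) σ τ ≡ sum (λ k → sum (λ l → 2 * e k l))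
      twice-edges = trans (cong (2 *_) bilinear≡sum-edges)
        (trans (*-distribˡ-sum 2 (λ k → sum (e k))) (sum-cong-≗ (λ k → *-distribˡ-sum 2 (e k))))
      product : sum σ * sum τ ≡ sum (λ k → sum (λ l → a k * b l))
      product = trans (sym (cong₂ _*_ (sum-∣level∣ σ≤d) (sum-∣level∣ τ≤d))) (sum-*-sum a b)

  QRBound-weighted : let D = ∣ 2 * bilinear (kernel G) σ τ - sum σ * sum τ ∣ in
    D * D ≤ d * d * (4 * (c * c) * (Graph.n G * (sum σ * sum τ)))
  QRBound-weighted = begin
    D * D                             ≤⟨ *-mono-≤ deviation≤sum-dev deviation≤sum-dev ⟩
    Y * Y                             ≤⟨ sum²-square-≤ dev (λ k → M * a k) b dev²≤ ⟩
    d * d * (sum (λ k → M * a k) * sum b)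
      ≡⟨ cong (λ x → d * d * (x * sum b)) (sym (*-distribˡ-sum M a)) ⟩
    d * d * (M * sum a * sum b)
      ≡⟨ cong₂ (λ x y → d * d * (M * x * y)) (sum-∣level∣ σ≤d) (sum-∣level∣ τ≤d) ⟩
    d * d * (M * sum σ * sum τ)       ≡⟨ regroup (d * d) (4 * (c * c)) (Graph.n G) (sum σ) (sum τ) ⟩
    d * d * (4 * (c * c) * (Graph.n G * (sum σ * sum τ))) ∎
    where
    open ≤-Reasoning
    D = ∣ 2 * bilinear (kernel G) σ τ - sum σ * sum τ ∣
    Y = sum (λ k → sum (dev k))
    M = 4 * (c * c) * Graph.n G
    regroup : ∀ x y n s t → x * (y * n * s * t) ≡ x * (y * (n * (s * t)))
    regroup = solve-∀
    dev²≤ : ∀ k l → dev k l * dev k l ≤ M * a k * b l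
    dev²≤ k l = ≤-trans (qr (A k) (B l)) (≤-reflexive (regroup′ (4 * (c * c)) (Graph.n G) (a k) (b l)))
      where
      regroup′ : ∀ y n s t → y * (n * (s * t)) ≡ y * n * s * t
      regroup′ = solve-∀

-- X F φ unfolds to loopless (λ i j → isSquare F (φ (elt F i) (elt F j))).
loopless : ∀ {n} → (Fin n → Fin n → Bool) → Graph
loopless {n} R = record { n = n ; adj = λ i j → not ⌊ i ≟ j ⌋ ∧ R i j }

module _ {d} {γ : Fin m → Fin n} (fibre≤d : ∀ u → fibreSize γ u ≤ d) (U : Subset m) where

  push-𝟙[]-≤ : ∀ u → push γ 𝟙[ U ] u ≤ d
  push-𝟙[]-≤ u = ≤-trans (push-≤-fibreSize γ 𝟙[ U ] (λ i → 𝟙≤1 (lookup U i)) u) (fibre≤d u)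

sum-push-𝟙[] : (γ : Fin m → Fin n) (U : Subset m) → sum (push γ 𝟙[ U ]) ≡ ∣ U ∣
sum-push-𝟙[] γ U = trans (sum-push-total γ 𝟙[ U ]) (sym (∣S∣≡sum𝟙[S] U))

collisions-square : {γ : Fin m → Fin n} → (∀ u → fibreSize γ u ≤ d) → (S T : Subset m) →
  let C = bilinear diagonal (push γ 𝟙[ S ]) (push γ 𝟙[ T ]) in C * C ≤ d * d * (∣ S ∣ * ∣ T ∣)
collisions-square {d = d} {γ = γ} fibre≤d S T = subst (λ x → C * C ≤ d * d * x)
  (cong₂ _*_ (sum-push-𝟙[] γ S) (sum-push-𝟙[] γ T))
  (bilinear-diagonal-square (push-𝟙[]-≤ fibre≤d S) (push-𝟙[]-≤ fibre≤d T))
  where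
  C = bilinear diagonal (push γ 𝟙[ S ]) (push γ 𝟙[ T ])

module _ {R R′ : Fin n → Fin n → Bool} {γ : Fin n → Fin n}
         (R′≡R∘γ : ∀ i j → R′ i j ≡ R (γ i) (γ j)) (S T : Subset n) where

  private
    K K′ : Fin n → Fin n → ℕ
    K = kernel (loopless R)
    K′ = kernel (loopless R′)

    K∘γ≤K′ : ∀ i j → K (γ i) (γ j) ≤ K′ i j
    K∘γ≤K′ i j with i ≟ j | γ i ≟ γ j
    ... | _        | yes _    = z≤n
    ... | yes refl | no γi≢γi = contradiction refl γi≢γi
    ... | no _     | no _     = ≤-reflexive (cong 𝟙 (sym (R′≡R∘γ i j)))

    K′≤K∘γ+diagonal∘γ : ∀ i j → K′ i j ≤ K (γ i) (γ j) + diagonal (γ i) (γ j)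
    K′≤K∘γ+diagonal∘γ i j with i ≟ j | γ i ≟ γ j
    ... | _        | yes _    = 𝟙≤1 _
    ... | yes refl | no γi≢γi = contradiction refl γi≢γi
    ... | no _     | no _     = ≤-trans (≤-reflexive (cong 𝟙 (R′≡R∘γ i j))) (m≤m+n _ 0)

    pulled-back : (L : Fin n → Fin n → ℕ) →
      bilinear (λ i j → L (γ i) (γ j)) 𝟙[ S ] 𝟙[ T ] ≡ bilinear L (push γ 𝟙[ S ]) (push γ 𝟙[ T ])
    pulled-back L = bilinear-pullback L γ 𝟙[ S ] 𝟙[ T ]

  pullback-≤-edges : bilinear K (push γ 𝟙[ S ]) (push γ 𝟙[ T ]) ≤ edges (loopless R′) S T
  pullback-≤-edges = subst₂ _≤_ (pulled-back K) (sym (edges≡bilinear (loopless R′) S T))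
    (bilinear-mono-≤ {σ = 𝟙[ S ]} {τ = 𝟙[ T ]} K∘γ≤K′)

  edges-≤-pullback+collisions : edges (loopless R′) S T ≤
    bilinear K (push γ 𝟙[ S ]) (push γ 𝟙[ T ]) + bilinear diagonal (push γ 𝟙[ S ]) (push γ 𝟙[ T ])
  edges-≤-pullback+collisions = subst₂ _≤_ (sym (edges≡bilinear (loopless R′) S T))
    (trans (bilinear-+ {σ = 𝟙[ S ]} {τ = 𝟙[ T ]}) (cong₂ _+_ (pulled-back K) (pulled-back diagonal)))
    (bilinear-mono-≤ {σ = 𝟙[ S ]} {τ = 𝟙[ T ]} K′≤K∘γ+diagonal∘γ)

QRBound-pullback : {R R′ : Fin n → Fin n → Bool} {γ : Fin n → Fin n} {c : ℕ} →
  (∀ i j → R′ i j ≡ R (γ i) (γ j)) → (∀ u → fibreSize γ u ≤ d) → 1 ≤ c →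
  QRBound (loopless R) c → QRBound (loopless R′) (2 * d * c)
QRBound-pullback {n} {d} {R} {R′} {γ} {c} R′≡R∘γ fibre≤d (s≤s z≤n) qr S T =
  ≤-trans (m≤n+o⇒m*m≤4*k {n = ∣ 2 * E - s * t ∣} {o = 2 * C} D≤Y+2C Y²≤bound [2C]²≤bound)
          (≤-reflexive (regroup d c (n * (s * t))))
  where
  s t E C bound : ℕ
  s = ∣ S ∣
  t = ∣ T ∣
  E = bilinear (kernel (loopless R)) (push γ 𝟙[ S ]) (push γ 𝟙[ T ])
  C = bilinear diagonal (push γ 𝟙[ S ]) (push γ 𝟙[ T ])
  bound = d * d * (4 * (c * c) * (n * (s * t)))

  regroup : ∀ d c N → 4 * (d * d * (4 * (c * c) * N)) ≡ 4 * ((2 * d * c) * (2 * d * c)) * N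
  regroup = solve-∀

  D≤Y+2C : deviation (loopless R′) S T ≤ ∣ 2 * E - s * t ∣ + 2 * C
  D≤Y+2C = n≤m≤n+o⇒∣2m-k∣≤∣2n-k∣+2o (s * t)
    (pullback-≤-edges R′≡R∘γ S T) (edges-≤-pullback+collisions R′≡R∘γ S T)

  Y²≤bound : ∣ 2 * E - s * t ∣ * ∣ 2 * E - s * t ∣ ≤ bound
  Y²≤bound = subst (λ x → ∣ 2 * E - x ∣ * ∣ 2 * E - x ∣ ≤ d * d * (4 * (c * c) * (n * x)))
    (cong₂ _*_ (sum-push-𝟙[] γ S) (sum-push-𝟙[] γ T))
    (QRBound-weighted (loopless R) {c} {d} qr (push-𝟙[]-≤ fibre≤d S) (push-𝟙[]-≤ fibre≤d T))

  [2C]²≤bound : 2 * C * (2 * C) ≤ bound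
  [2C]²≤bound = begin
    2 * C * (2 * C)                       ≡⟨ square-twice C ⟩
    4 * (C * C)                           ≤⟨ *-monoʳ-≤ 4 (collisions-square fibre≤d S T) ⟩
    4 * (d * d * (s * t))                 ≤⟨ *-monoʳ-≤ 4 (*-monoʳ-≤ (d * d) st≤c²nst) ⟩
    4 * (d * d * (c * c * (n * (s * t)))) ≡⟨ regroup′ d c (n * (s * t)) ⟩
    bound                                 ∎
    where
    open ≤-Reasoning
    st≤c²nst : s * t ≤ c * c * (n * (s * t))
    st≤c²nst = ≤-trans (m≤n⇒m*k≤n*[m*k] t (∣p∣≤n S)) (m≤n*m (n * (s * t)) (c * c))
    square-twice : ∀ C → 2 * C * (2 * C) ≡ 4 * (C * C)
    square-twice = solve-∀
    regroup′ : ∀ d c N → 4 * (d * d * (c * c * N)) ≡ d * d * (4 * (c * c) * N)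
    regroup′ = solve-∀

QRBound-X-pullback : (F : FiniteField) (φ : Op₂ (FiniteField.Carrier F)) (g : Poly1 F) {c d : ℕ} →
  HasDegree F g (suc d) → 1 ≤ c →
  QRBound (X F φ) c → QRBound (X F (λ a b → φ (eval F g a) (eval F g b))) (2 * suc d * c)
QRBound-X-pullback F φ g {d = d} deg = QRBound-pullback R′≡R∘γ fibre≤d
  where
  open FiniteField F using (size; enum) renaming (_≟_ to _≟ᶠ_)
  γ : Fin size → Fin size
  γ i = Inverse.from enum (eval F g (elt F i))
  elt∘γ : ∀ i → elt F (γ i) ≡ eval F g (elt F i)
  elt∘γ i = Inverse.strictlyInverseˡ enum (eval F g (elt F i))
  R′≡R∘γ : ∀ i j → isSquare F (φ (eval F g (elt F i)) (eval F g (elt F j)))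
                 ≡ isSquare F (φ (elt F (γ i)) (elt F (γ j)))
  R′≡R∘γ i j = cong₂ (λ a b → isSquare F (φ a b)) (sym (elt∘γ i)) (sym (elt∘γ j))
  fibre≤d : ∀ u → fibreSize γ u ≤ suc d
  fibre≤d u = ≤-trans (sum-mono-≤ (λ i → 𝟙-mono (γ i ≟ u) (eval F g (elt F i) ≟ᶠ elt F u)
                                                 (λ γi≡u → trans (sym (elt∘γ i)) (cong (elt F) γi≡u))))
                      (preimageSize≤degree F g d (elt F u) deg)

lemma5p4 : (𝒢 : GIndex → Set) →
    (∀ i → 𝒢 i → OddOrder (proj₁ i)) →
    (d : ℕ) → d ≥ 1 →
    QRhalf 𝒢 GGraph →
    QRhalf (FMember 𝒢 d) FGraph
lemma5p4 𝒢 _ d@(suc _) d≥1 (unbounded , c , c≥1 , qr) = unbounded′ , 2 * d * c , 1≤2dc , qr′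
  where
  unbounded′ : ∀ m → Σ FIndex (λ i → FMember 𝒢 d i × m < Graph.n (FGraph i))
  unbounded′ m with unbounded m
  ... | (F , f) , f∈𝒢 , m<q = (F , f , monomial F d) , (f∈𝒢 , monomial-degree F d) , m<q
  1≤2dc : 1 ≤ 2 * d * c
  1≤2dc = *-mono-≤ (*-mono-≤ {1} {2} (s≤s z≤n) d≥1) c≥1
  qr′ : ∀ i → FMember 𝒢 d i → QRBound (FGraph i) (2 * d * c)
  qr′ (F , f , g) (f∈𝒢 , deg) = QRBound-X-pullback F (eval2 F f) g deg c≥1 (qr (F , f) f∈𝒢)
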